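{- Let $G$ be a $5/4$-structured graph and let $C=x_1x_2x_3x_4x_5x_6$ be a cycle of length $6$ in $G$ (on distinct vertices $x_1,\dots,x_6$). Suppose that there is at most one pair of distinct vertices $\{x,x'\}\subseteq\{x_1,x_3,x_5\}$ for which $G[V(C)]$ contains a Hamiltonian path with endpoints $x$ and $x'$. Then there are at least two distinct edges of $G$ that are not in $G[V(C)]$ and are incident to vertices in $\{x_2,x_4,x_6\}$.
   Context: A graph is 2EC if it is connected and remains connected after deleting any edge; 2VC if connected, at least three vertices, no cut vertex. For $\alpha>1$, $G$ is $\alpha$-structured if it is simple, 2VC, has at least $\frac{4}{\alpha-1}$ vertices, and: (1) it has no $\alpha$-contractible subgraph with at most $\frac{2}{\alpha-1}$ vertices, where a subgraph $C$ is $\alpha$-contractible if it is 2EC and every 2EC spanning subgraph of $G$ contains at least $|E(C)|/\alpha$ edges of $G[V(C)]$; (2) it has no edge $uv$ such that $\{u,v\}$ is a 2-vertex cut; (3) every 2-vertex cut $\{u,v\}$ leaves exactly two connected components, one of which is a single vertex. $G[W]$ denotes the subgraph induced by $W$. -}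

module Defs where

open import Data.Nat using (ℕ; zero; suc; _+_; _*_; _∸_; _≤_; _<_; _<ᵇ_)
open import Data.Bool using (Bool; true; false; _∧_; not; if_then_else_)
open import Data.Fin using (Fin; toℕ) renaming (zero to f0; suc to fs)
open import Data.Fin.Properties using (_≟_)
open import Data.List using (List; map; allFin)
open import Data.Nat.ListAction using (sum)
open import Data.Product using (Σ; _×_; _,_; ∃)
open import Data.Sum using (_⊎_)
open import Relation.Nullary using (¬_)
open import Relation.Nullary.Decidable using (⌊_⌋)
open import Relation.Binary.PropositionalEquality using (_≡_; _≢_)

VSet : ℕ → Set
VSet n = Fin n → Bool

ESet : ℕ → Set
ESet n = Fin n → Fin n → Bool

record Graph (n : ℕ) : Set where
  field
    adj   : ESet n
    sym   : ∀ u v → adj u v ≡ true → adj v u ≡ true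
    irrefl : ∀ u → adj u u ≡ false
open Graph public

allV : ∀ {n} → VSet n
allV _ = true

delV : ∀ {n} → VSet n → Fin n → VSet n
delV V w u = V u ∧ not ⌊ u ≟ w ⌋

delE : ∀ {n} → ESet n → Fin n → Fin n → ESet n
delE E a b u v =
  E u v ∧ not ((⌊ u ≟ a ⌋ ∧ ⌊ v ≟ b ⌋) ∨' (⌊ u ≟ b ⌋ ∧ ⌊ v ≟ a ⌋))
  where
  _∨'_ : Bool → Bool → Bool
  true ∨' _ = true
  false ∨' y = y

data Reach {n : ℕ} (V : VSet n) (E : ESet n) : Fin n → Fin n → Set where
  here : ∀ {u} → V u ≡ true → Reach V E u u
  step : ∀ {u v w} → V u ≡ true → E u v ≡ true → Reach V E v w → Reach V E u w

-- (V , E) is connected (a graph with empty vertex set counts as connected;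
-- this case never matters below).
Connected : ∀ {n} → VSet n → ESet n → Set
Connected V E = ∀ u v → V u ≡ true → V v ≡ true → Reach V E u v

TwoEC : ∀ {n} → VSet n → ESet n → Set
TwoEC V E = Connected V E × (∀ a b → E a b ≡ true → Connected V (delE E a b))

countV : ∀ {n} → VSet n → ℕ
countV {n} V = sum (map (λ u → if V u then 1 else 0) (allFin n))

countE : ∀ {n} → VSet n → ESet n → ℕ
countE {n} V E = sum (map (λ u → sum (map (λ v →
  if E u v ∧ V u ∧ V v ∧ (toℕ u <ᵇ toℕ v) then 1 else 0) (allFin n))) (allFin n))

TwoVC : ∀ {n} → Graph n → Set
TwoVC {n} G = Connected allV (adj G) × 3 ≤ n × (∀ w → Connected (delV allV w) (adj G))

record Subgraph {n : ℕ} (G : Graph n) : Set where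
  field
    V : VSet n
    E : ESet n
    E⊆G   : ∀ u v → E u v ≡ true → adj G u v ≡ true
    Esym  : ∀ u v → E u v ≡ true → E v u ≡ true
    Eends : ∀ u v → E u v ≡ true → (V u ≡ true) × (V v ≡ true)
open Subgraph public

record SpanningSub {n : ℕ} (G : Graph n) : Set where
  field
    H : ESet n
    H⊆G  : ∀ u v → H u v ≡ true → adj G u v ≡ true
    Hsym : ∀ u v → H u v ≡ true → H v u ≡ true
open SpanningSub public

-- α = p / q  (with p > q).  C is α-contractible if it is 2EC (and nontrivial,
-- i.e. has at least two vertices) and every 2EC spanning subgraph H of G
-- contains at least |E(C)|/α edges of G[V(C)], i.e.  p·k ≥ q·|E(C)|.
Contractible : ∀ {n} (p q : ℕ) (G : Graph n) → Subgraph G → Set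
Contractible p q G C =
  2 ≤ countV (V C) × TwoEC (V C) (E C) ×
  (∀ (S : SpanningSub G) → TwoEC allV (H S) →
     q * countE (V C) (E C) ≤ p * countE (V C) (H S))

TwoVCut : ∀ {n} → Graph n → Fin n → Fin n → Set
TwoVCut G u v = u ≢ v × ¬ Connected (delV (delV allV u) v) (adj G)

-- α-structured for α = p/q > 1:
--   simple (built into Graph), 2VC, n ≥ 4/(α-1) i.e. (p-q)·n ≥ 4q,
--   (1) no α-contractible subgraph with ≤ 2/(α-1) vertices, i.e. (p-q)·|V(C)| ≤ 2q,
--   (2) no edge uv with {u,v} a 2-vertex cut,
--   (3) every 2-vertex cut {u,v} leaves exactly two components, one a single
--       vertex w: w is isolated in G-{u,v} and G-{u,v,w} is connected.
Structured : ∀ {n} (p q : ℕ) → Graph n → Set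
Structured {n} p q G =
  q < p × TwoVC G × 4 * q ≤ (p ∸ q) * n ×
  (∀ (C : Subgraph G) → (p ∸ q) * countV (V C) ≤ 2 * q → ¬ Contractible p q G C) ×
  (∀ u v → adj G u v ≡ true → ¬ TwoVCut G u v) ×
  (∀ u v → TwoVCut G u v →
     Σ (Fin n) λ w → w ≢ u × w ≢ v ×
       (∀ y → adj G w y ≡ true → (y ≡ u) ⊎ (y ≡ v)) ×
       Connected (delV (delV (delV allV u) v) w) (adj G))

next6 : Fin 6 → Fin 6
next6 f0 = fs f0
next6 (fs f0) = fs (fs f0)
next6 (fs (fs f0)) = fs (fs (fs f0))
next6 (fs (fs (fs f0))) = fs (fs (fs (fs f0)))
next6 (fs (fs (fs (fs f0)))) = fs (fs (fs (fs (fs f0))))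
next6 (fs (fs (fs (fs (fs f0))))) = f0

IsCycle6 : ∀ {n} → Graph n → (Fin 6 → Fin n) → Set
IsCycle6 G x = (∀ i j → x i ≡ x j → i ≡ j) × (∀ i → adj G (x i) (x (next6 i)) ≡ true)

InC : ∀ {n} → (Fin 6 → Fin n) → Fin n → Set
InC x v = Σ (Fin 6) λ i → x i ≡ v

idx : Fin 5 → Fin 6
idx = Data.Fin.inject₁
  where import Data.Fin

sucIdx : Fin 5 → Fin 6
sucIdx = fs

HamPath : ∀ {n} → Graph n → (Fin 6 → Fin n) → Fin n → Fin n → Set
HamPath {n} G x a b = Σ (Fin 6 → Fin n) λ P →
  (∀ i j → P i ≡ P j → i ≡ j) × (∀ i → InC x (P i)) ×
  (∀ (i : Fin 5) → adj G (P (idx i)) (P (sucIdx i)) ≡ true) ×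
  P f0 ≡ a × P (fs (fs (fs (fs (fs f0))))) ≡ b

SameEdge : ∀ {n} → Fin n → Fin n → Fin n → Fin n → Set
SameEdge a b c d = (a ≡ c × b ≡ d) ⊎ (a ≡ d × b ≡ c)

HamEnds : ∀ {n} → Graph n → (Fin 6 → Fin n) → Fin n → Fin n → Set
HamEnds G x a b = HamPath G x a b ⊎ HamPath G x b a

-- v ∈ {x₂, x₄, x₆}  (x is 0-indexed: x₂ = x 1, x₄ = x 3, x₆ = x 5)
InEvens : ∀ {n} → (Fin 6 → Fin n) → Fin n → Set
InEvens x v = x (fs f0) ≡ v ⊎ x (fs (fs (fs f0))) ≡ v ⊎ x (fs (fs (fs (fs (fs f0))))) ≡ v

module Submission where

-- If at most one edge leaves V(C) from x₂, x₄, x₆, the hexagon C is 5/4-contractible with six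
-- vertices, which a 5/4-structured graph forbids. A chord between two of x₂, x₄, x₆ yields
-- Hamiltonian paths of G[V(C)] joining two pairs from {x₁, x₃, x₅}, which the hypothesis excludes;
-- so x₂, x₄, x₆ are pairwise non-adjacent. In a 2EC spanning subgraph each of them has two
-- neighbours, all inside V(C) but for the single exit edge; by independence these 2 + 2 + 1 edges
-- are distinct, and 4 · |E(C)| = 24 ≤ 5 · 5.

open import Defs renaming (sym to adj-sym)
open import Data.Nat using (ℕ; zero; suc; _+_; _*_; _∸_; _≤_; _<ᵇ_; z≤n)
open import Data.Nat.Properties
  using (+-mono-≤; +-monoʳ-≤; *-monoʳ-≤; m≤m+n; n≤1+n; m≤n+m; +-comm; +-identityʳ;
         ≤-refl; ≤-trans; ≤-reflexive; ≤-antisym; <ᵇ-reflects-<; <⇒≯; ≮⇒≥;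
         *-cancelˡ-≡; *-cancelˡ-≤; module ≤-Reasoning)
open import Data.Bool using (Bool; true; false; _∧_; if_then_else_)
open import Data.Bool.Properties using (¬-not) renaming (_≟_ to _≟ᵇ_)
open import Data.Fin using (Fin; toℕ; inject₁) renaming (zero to f0; suc to fs)
open import Data.Fin.Patterns using (0F; 1F; 2F; 3F; 4F; 5F)
open import Data.Fin.Properties using (_≟_; any?; all?; toℕ-injective; toℕ-inject₁)
open import Data.List using (map; allFin; tabulate)
open import Data.List.Properties using (map-tabulate)
import Data.Nat.ListAction as List
open import Data.Product using (Σ; _×_; _,_; proj₁; proj₂; ∃₂)
open import Data.Sum using (_⊎_; inj₁; inj₂; [_,_]; [_,_]′; swap)
open import Data.Unit using (tt)
open import Data.Empty using (⊥; ⊥-elim)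
open import Data.Vec using (Vec; _∷_; []; lookup)
open import Function using (_∘_; id; mk⇔)
open import Function.Definitions using (Injective)
open import Relation.Nullary using (¬_; Dec; yes; no; contradiction)
open import Relation.Nullary.Reflects using (ofʸ; ofⁿ)
open import Relation.Nullary.Decidable
  using (does; does-⇔; True; toWitness; dec-true; dec-false; decidable-stable;
         ¬?; _×-dec_; _⊎-dec_; _→-dec_)
open import Relation.Binary.PropositionalEquality
  using (_≡_; _≢_; refl; sym; trans; cong; cong₂; subst; subst₂; module ≡-Reasoning)
open import Algebra.Properties.CommutativeMonoid.Sum Data.Nat.Properties.+-0-commutativeMonoid
  using (sum; sum-syntax; ∑-distrib-+; ∑-comm; sum-cong-≗; sum-replicate-zero)

𝟙 : Bool → ℕ
𝟙 b = if b then 1 else 0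

∑-fromList : ∀ k (f : Fin k → ℕ) → List.sum (map f (allFin k)) ≡ ∑[ i < k ] f i
∑-fromList k f = trans (cong List.sum (map-tabulate id f)) (go k f)
  where
  go : ∀ k (f : Fin k → ℕ) → List.sum (tabulate f) ≡ ∑[ i < k ] f i
  go zero    f = refl
  go (suc k) f = cong (f f0 +_) (go k (f ∘ fs))

∑-one : ∀ k → ∑[ i < k ] 1 ≡ k
∑-one zero    = refl
∑-one (suc k) = cong suc (∑-one k)

∑-mono-≤ : ∀ {k} {f g : Fin k → ℕ} → (∀ i → f i ≤ g i) → ∑[ i < k ] f i ≤ ∑[ i < k ] g i
∑-mono-≤ {zero}  f≤g = z≤n
∑-mono-≤ {suc k} f≤g = +-mono-≤ (f≤g f0) (∑-mono-≤ (f≤g ∘ fs))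

∑-≥-term : ∀ {k} (f : Fin k → ℕ) i → f i ≤ ∑[ j < k ] f j
∑-≥-term f f0     = m≤m+n _ _
∑-≥-term f (fs i) = ≤-trans (∑-≥-term (f ∘ fs) i) (m≤n+m _ _)

∑-≥-two-terms : ∀ {k} (f : Fin k → ℕ) {i j} → i ≢ j → f i + f j ≤ ∑[ l < k ] f l
∑-≥-two-terms f {f0}   {f0}   i≢j = contradiction refl i≢j
∑-≥-two-terms f {f0}   {fs j} _   = +-monoʳ-≤ (f f0) (∑-≥-term (f ∘ fs) j)
∑-≥-two-terms f {fs i} {f0}   _   =
  subst (_≤ ∑[ l < _ ] f l) (+-comm (f f0) _) (+-monoʳ-≤ (f f0) (∑-≥-term (f ∘ fs) i))
∑-≥-two-terms f {fs i} {fs j} i≢j =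
  ≤-trans (∑-≥-two-terms (f ∘ fs) (i≢j ∘ cong fs)) (m≤n+m _ _)

∑-if : ∀ k b (g : Fin k → ℕ) → ∑[ i < k ] (if b then g i else 0) ≡ (if b then ∑[ i < k ] g i else 0)
∑-if k true  g = refl
∑-if k false g = sum-replicate-zero k

∑-δ : ∀ {k} a (g : Fin k → ℕ) → ∑[ i < k ] (if does (i ≟ a) then g i else 0) ≡ g a
∑-δ {suc k} f0 g = trans (cong (g f0 +_) (sum-replicate-zero k)) (+-identityʳ _)
∑-δ {suc k} (fs a) g = ∑-δ a (g ∘ fs)

<ᵇ-exactly-one : ∀ {m n} → m ≢ n → 𝟙 (m <ᵇ n) + 𝟙 (n <ᵇ m) ≡ 1
<ᵇ-exactly-one {m} {n} m≢n with m <ᵇ n | <ᵇ-reflects-< m n | n <ᵇ m | <ᵇ-reflects-< n m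
... | true  | ofʸ m<n | true  | ofʸ n<m = contradiction n<m (<⇒≯ m<n)
... | true  | _       | false | _       = refl
... | false | _       | true  | _       = refl
... | false | ofⁿ m≮n | false | ofⁿ n≮m = contradiction (≤-antisym (≮⇒≥ n≮m) (≮⇒≥ m≮n)) m≢n

2*m≡m+m : ∀ m → 2 * m ≡ m + m
2*m≡m+m m = cong (m +_) (+-identityʳ m)

∑∑-distrib-+ : ∀ {k} (f g : Fin k → Fin k → ℕ) →
  ∑[ a < k ] ∑[ b < k ] (f a b + g a b) ≡ ∑[ a < k ] ∑[ b < k ] f a b + ∑[ a < k ] ∑[ b < k ] g a b
∑∑-distrib-+ {k} f g = trans (sum-cong-≗ {k} (λ a → ∑-distrib-+ (f a) (g a))) (∑-distrib-+ {k} _ _)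

-- The double sum counts each edge at an endpoint in P from both sides, and no edge has both ends in P.
∑-independent-degrees : ∀ {k} (P : Fin k → Bool) (M : Fin k → Fin k → ℕ) →
  (∀ a b → M a b ≡ M b a) → (∀ a b → P a ≡ true → P b ≡ true → M a b ≡ 0) →
  2 * ∑[ a < k ] (if P a then ∑[ b < k ] M a b else 0) ≤ ∑[ a < k ] ∑[ b < k ] M a b
∑-independent-degrees {k} P M M-sym P-indep = begin
  2 * Q                                               ≡⟨ 2*m≡m+m Q ⟩
  Q + Q                                               ≡⟨ cong₂ _+_ rows columns ⟨
  ∑[ a < k ] ∑[ b < k ] A a b + ∑[ a < k ] ∑[ b < k ] B a b ≡⟨ ∑∑-distrib-+ A B ⟨
  ∑[ a < k ] ∑[ b < k ] (A a b + B a b)               ≤⟨ ∑-mono-≤ (λ a → ∑-mono-≤ (pointwise a)) ⟩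
  ∑[ a < k ] ∑[ b < k ] M a b                         ∎
  where
  open ≤-Reasoning
  Q : ℕ
  Q = ∑[ a < k ] (if P a then ∑[ b < k ] M a b else 0)
  A B : Fin k → Fin k → ℕ
  A a b = if P a then M a b else 0
  B a b = if P b then M a b else 0
  rows : ∑[ a < k ] ∑[ b < k ] A a b ≡ Q
  rows = sum-cong-≗ {k} (λ a → ∑-if k (P a) (M a))
  columns : ∑[ a < k ] ∑[ b < k ] B a b ≡ Q
  columns = trans (∑-comm {k} {k} B) (sum-cong-≗ {k} λ b →
    trans (∑-if k (P b) (λ a → M a b)) (cong (if P b then_else 0) (sum-cong-≗ {k} (λ a → M-sym a b))))
  pointwise : ∀ a b → A a b + B a b ≤ M a b
  pointwise a b with P a in Pa | P b in Pb
  ... | true  | true  rewrite P-indep a b Pa Pb = z≤n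
  ... | true  | false = ≤-reflexive (+-identityʳ _)
  ... | false | true  = ≤-refl
  ... | false | false = z≤n

image? : ∀ {k n} (x : Fin k → Fin n) u → Dec (Σ (Fin k) λ i → x i ≡ u)
image? x u = any? λ i → x i ≟ u

Image : ∀ {k n} → (Fin k → Fin n) → VSet n
Image x u = does (image? x u)

module _ {k n} {x : Fin k → Fin n} (x-inj : Injective _≡_ _≡_ x) where

  ≟-image : ∀ a i → does (x a ≟ x i) ≡ does (i ≟ a)
  ≟-image a i with i ≟ a
  ... | yes refl = dec-true (x a ≟ x a) refl
  ... | no i≢a   = dec-false (x a ≟ x i) (λ xa≡xi → i≢a (sym (x-inj xa≡xi)))

  ∑-indicator-image : ∀ u c → ∑[ i < k ] (if does (u ≟ x i) then c else 0) ≡ (if Image x u then c else 0)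
  ∑-indicator-image u c with image? x u
  ... | yes (a , refl) =
    trans (sum-cong-≗ (λ i → cong (if_then c else 0) (≟-image a i))) (∑-δ a (λ _ → c))
  ... | no u∉x =
    trans (sum-cong-≗ λ i → cong (if_then c else 0) (dec-false (u ≟ x i) (u∉x ∘ (i ,_) ∘ sym)))
          (sum-replicate-zero k)

  ∑-image : (g : Fin n → ℕ) → ∑[ u < n ] (if Image x u then g u else 0) ≡ ∑[ i < k ] g (x i)
  ∑-image g = begin
    ∑[ u < n ] (if Image x u then g u else 0)
      ≡⟨ sum-cong-≗ (λ u → ∑-indicator-image u (g u)) ⟨
    ∑[ u < n ] ∑[ i < k ] (if does (u ≟ x i) then g u else 0)
      ≡⟨ ∑-comm {n} {k} _ ⟩
    ∑[ i < k ] ∑[ u < n ] (if does (u ≟ x i) then g u else 0)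
      ≡⟨ sum-cong-≗ (λ i → ∑-δ (x i) g) ⟩
    ∑[ i < k ] g (x i) ∎
    where open ≡-Reasoning

  countV-image : countV (Image x) ≡ k
  countV-image = trans (∑-fromList n _) (trans (∑-image (λ _ → 1)) (∑-one k))

  countE-image : (E : ESet n) →
    countE (Image x) E ≡ ∑[ a < k ] ∑[ b < k ] 𝟙 (E (x a) (x b) ∧ (toℕ (x a) <ᵇ toℕ (x b)))
  countE-image E = begin
    countE (Image x) E
      ≡⟨ trans (∑-fromList n _) (sum-cong-≗ {n} λ u → ∑-fromList n _) ⟩
    ∑[ u < n ] ∑[ v < n ] 𝟙 (E u v ∧ Image x u ∧ Image x v ∧ (toℕ u <ᵇ toℕ v))
      ≡⟨ sum-cong-≗ (λ u → trans (sum-cong-≗ (split u)) (∑-if n (Image x u) _)) ⟩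
    ∑[ u < n ] (if Image x u then ∑[ v < n ] (if Image x v then h u v else 0) else 0)
      ≡⟨ sum-cong-≗ (λ u → cong (if Image x u then_else 0) (∑-image (h u))) ⟩
    ∑[ u < n ] (if Image x u then ∑[ b < k ] h u (x b) else 0)
      ≡⟨ ∑-image _ ⟩
    ∑[ a < k ] ∑[ b < k ] h (x a) (x b) ∎
    where
    open ≡-Reasoning
    h : Fin n → Fin n → ℕ
    h u v = 𝟙 (E u v ∧ (toℕ u <ᵇ toℕ v))
    split : ∀ u v → 𝟙 (E u v ∧ Image x u ∧ Image x v ∧ (toℕ u <ᵇ toℕ v)) ≡
                    (if Image x u then (if Image x v then h u v else 0) else 0)
    split u v with E u v | Image x u | Image x v
    ... | true  | true  | true  = refl
    ... | true  | true  | false = refl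
    ... | true  | false | _     = refl
    ... | false | true  | true  = refl
    ... | false | true  | false = refl
    ... | false | false | _     = refl

  countE-double : (E : ESet n) →
    (∀ a b → E (x a) (x b) ≡ E (x b) (x a)) → (∀ a → E (x a) (x a) ≡ false) →
    2 * countE (Image x) E ≡ ∑[ a < k ] ∑[ b < k ] 𝟙 (E (x a) (x b))
  countE-double E E-sym E-irrefl = begin
    2 * countE (Image x) E                   ≡⟨ cong (2 *_) (countE-image E) ⟩
    2 * ∑T                                   ≡⟨ 2*m≡m+m ∑T ⟩
    ∑T + ∑T                                  ≡⟨ cong (∑T +_) (∑-comm {k} {k} T) ⟩
    ∑T + ∑[ a < k ] ∑[ b < k ] T b a         ≡⟨ ∑∑-distrib-+ T (λ a b → T b a) ⟨
    ∑[ a < k ] ∑[ b < k ] (T a b + T b a)    ≡⟨ sum-cong-≗ {k} (λ a → sum-cong-≗ {k} (pair a)) ⟩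
    ∑[ a < k ] ∑[ b < k ] 𝟙 (E (x a) (x b))  ∎
    where
    open ≡-Reasoning
    T : Fin k → Fin k → ℕ
    T a b = 𝟙 (E (x a) (x b) ∧ (toℕ (x a) <ᵇ toℕ (x b)))
    ∑T : ℕ
    ∑T = ∑[ a < k ] ∑[ b < k ] T a b
    pair : ∀ a b → T a b + T b a ≡ 𝟙 (E (x a) (x b))
    pair a b with a ≟ b
    ... | yes refl rewrite E-irrefl a = refl
    ... | no a≢b rewrite E-sym b a with E (x a) (x b)
    ...   | false = refl
    ...   | true  = <ᵇ-exactly-one (a≢b ∘ x-inj ∘ toℕ-injective)

witness : ∀ {a} {A : Set a} (a? : Dec A) → does a? ≡ true → A
witness (yes a) _ = a

edge-comm : ∀ {n} {E : ESet n} → (∀ u v → E u v ≡ true → E v u ≡ true) → ∀ u v → E u v ≡ E v u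
edge-comm {E = E} E-sym u v with E u v in uv | E v u in vu
... | true  | true  = refl
... | false | false = refl
... | true  | false = contradiction (trans (sym (E-sym u v uv)) vu) λ ()
... | false | true  = contradiction (trans (sym (E-sym v u vu)) uv) λ ()

edge-absent : ∀ {n} {E F : ESet n} → (∀ u v → E u v ≡ true → F u v ≡ true) →
  ∀ {u v} → F u v ≡ false → E u v ≡ false
edge-absent E⊆F {u} {v} Fuv = ¬-not λ Euv → contradiction (trans (sym Fuv) (E⊆F u v Euv)) λ ()

sameEdge? : ∀ {n} (a b c d : Fin n) → Dec (SameEdge a b c d)
sameEdge? a b c d = (a ≟ c ×-dec b ≟ d) ⊎-dec (a ≟ d ×-dec b ≟ c)

SameEdge-flip : ∀ {n} {a b c d : Fin n} → SameEdge a b c d → SameEdge b a c d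
SameEdge-flip (inj₁ (a≡c , b≡d)) = inj₂ (b≡d , a≡c)
SameEdge-flip (inj₂ (a≡d , b≡c)) = inj₁ (b≡c , a≡d)

SameEdge-flipʳ : ∀ {n} {a b c d : Fin n} → SameEdge a b c d → SameEdge a b d c
SameEdge-flipʳ (inj₁ (a≡c , b≡d)) = inj₂ (a≡c , b≡d)
SameEdge-flipʳ (inj₂ (a≡d , b≡c)) = inj₁ (a≡d , b≡c)

SameEdge-inj : ∀ {k n} {x : Fin k → Fin n} → Injective _≡_ _≡_ x → ∀ {a b c d} →
  SameEdge (x a) (x b) (x c) (x d) → SameEdge a b c d
SameEdge-inj x-inj (inj₁ (p , q)) = inj₁ (x-inj p , x-inj q)
SameEdge-inj x-inj (inj₂ (p , q)) = inj₂ (x-inj p , x-inj q)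

delE-elim : ∀ {n} (E : ESet n) a b u v → delE E a b u v ≡ true → E u v ≡ true × ¬ SameEdge u v a b
delE-elim E a b u v e with E u v | u ≟ a | v ≟ b | u ≟ b | v ≟ a
delE-elim E a b u v () | false | _ | _ | _ | _
delE-elim E a b u v () | true | yes _ | yes _ | _ | _
delE-elim E a b u v () | true | yes _ | no _ | yes _ | yes _
delE-elim E a b u v () | true | no _ | _ | yes _ | yes _
... | true | yes _   | no v≢b | yes _   | no v≢a = refl , [ v≢b ∘ proj₂ , v≢a ∘ proj₂ ]
... | true | yes _   | no v≢b | no u≢b  | _      = refl , [ v≢b ∘ proj₂ , u≢b ∘ proj₁ ]
... | true | no u≢a  | _      | yes _   | no v≢a = refl , [ u≢a ∘ proj₁ , v≢a ∘ proj₂ ]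
... | true | no u≢a  | _      | no u≢b  | _      = refl , [ u≢a ∘ proj₁ , u≢b ∘ proj₁ ]

delE-intro : ∀ {n} (E : ESet n) a b u v → E u v ≡ true → ¬ SameEdge u v a b → delE E a b u v ≡ true
delE-intro E a b u v Euv ¬same with E u v | u ≟ a | v ≟ b | u ≟ b | v ≟ a
... | true | yes u≡a | yes v≡b | _       | _       = contradiction (inj₁ (u≡a , v≡b)) ¬same
... | true | _       | _       | yes u≡b | yes v≡a = contradiction (inj₂ (u≡b , v≡a)) ¬same
... | true | yes _   | no _    | yes _   | no _    = refl
... | true | yes _   | no _    | no _    | _       = refl
... | true | no _    | _       | yes _   | no _    = refl
... | true | no _    | _       | no _    | _       = refl

delE-⊆ : ∀ {n} (E : ESet n) a b u v → delE E a b u v ≡ true → E u v ≡ true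
delE-⊆ E a b u v = proj₁ ∘ delE-elim E a b u v

delE-comm : ∀ {n} (E : ESet n) a b u v → delE E a b u v ≡ true → delE E b a u v ≡ true
delE-comm E a b u v e = let Euv , ¬same = delE-elim E a b u v e in
  delE-intro E b a u v Euv (¬same ∘ SameEdge-flipʳ)

delE-sym : ∀ {n} (E : ESet n) a b → (∀ u v → E u v ≡ true → E v u ≡ true) →
  ∀ u v → delE E a b u v ≡ true → delE E a b v u ≡ true
delE-sym E a b E-sym u v e = let Euv , ¬same = delE-elim E a b u v e in
  delE-intro E a b v u (E-sym u v Euv) (¬same ∘ SameEdge-flip)

module _ {n} {V : VSet n} {E : ESet n} where

  Reach-start : ∀ {u w} → Reach V E u w → V u ≡ true
  Reach-start (here Vu)     = Vu
  Reach-start (step Vu _ _) = Vu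

  Reach-trans : ∀ {u v w} → Reach V E u v → Reach V E v w → Reach V E u w
  Reach-trans (here _)       r = r
  Reach-trans (step Vu uv r) r′ = step Vu uv (Reach-trans r r′)

  Reach-reverse : (∀ u v → E u v ≡ true → E v u ≡ true) → ∀ {u w} → Reach V E u w → Reach V E w u
  Reach-reverse E-sym (here Vu)     = here Vu
  Reach-reverse E-sym (step Vu uv r) =
    Reach-trans (Reach-reverse E-sym r) (step (Reach-start r) (E-sym _ _ uv) (here Vu))

  Reach-mono : ∀ {F : ESet n} → (∀ u v → E u v ≡ true → F u v ≡ true) →
    ∀ {u w} → Reach V E u w → Reach V F u w
  Reach-mono E⊆F (here Vu)      = here Vu
  Reach-mono E⊆F (step Vu uv r) = step Vu (E⊆F _ _ uv) (Reach-mono E⊆F r)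

  Connected-mono : ∀ {F : ESet n} → (∀ u v → E u v ≡ true → F u v ≡ true) → Connected V E → Connected V F
  Connected-mono E⊆F conn u v Vu Vv = Reach-mono E⊆F (conn u v Vu Vv)

  Reach-along : ∀ {m} (y : Fin (suc m) → Fin n) → (∀ t → V (y t) ≡ true) →
    (∀ (t : Fin m) → E (y (inject₁ t)) (y (fs t)) ≡ true) → ∀ t → Reach V E (y f0) (y t)
  Reach-along         y yV yE f0     = here (yV f0)
  Reach-along {suc m} y yV yE (fs t) = step (yV f0) (yE f0) (Reach-along (y ∘ fs) (yV ∘ fs) (yE ∘ fs) t)

  connected-along : (∀ u v → E u v ≡ true → E v u ≡ true) → ∀ {m} (y : Fin (suc m) → Fin n) →
    (∀ t → V (y t) ≡ true) → (∀ (t : Fin m) → E (y (inject₁ t)) (y (fs t)) ≡ true) →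
    (∀ u → V u ≡ true → Σ (Fin (suc m)) λ t → y t ≡ u) → Connected V E
  connected-along E-sym y yV yE covers u v Vu Vv with covers u Vu | covers v Vv
  ... | s , refl | t , refl = Reach-trans (Reach-reverse E-sym (along s)) (along t)
    where along = Reach-along y yV yE

two-neighbours : ∀ {n} {H : ESet n} → TwoEC allV H → ∀ {z w} → z ≢ w →
  ∃₂ λ u₁ u₂ → H z u₁ ≡ true × H z u₂ ≡ true × u₁ ≢ u₂
two-neighbours {H = H} (conn , conn-del) {z} {w} z≢w with conn z w refl refl
... | here _ = contradiction refl z≢w
... | step {v = u₁} _ zu₁ _ with conn-del z u₁ zu₁ z w refl refl
...   | here _ = contradiction refl z≢w
...   | step {v = u₂} _ zu₂ _ =
  let Hzu₂ , ¬same = delE-elim H z u₁ z u₂ zu₂ in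
  u₁ , u₂ , zu₁ , Hzu₂ , λ u₁≡u₂ → ¬same (inj₁ (refl , sym u₁≡u₂))

Rim : Fin 6 → Fin 6 → Set
Rim a b = next6 a ≡ b ⊎ next6 b ≡ a

rim? : ∀ a b → Dec (Rim a b)
rim? a b = next6 a ≟ b ⊎-dec next6 b ≟ a

around : ℕ → Fin 6 → Fin 6
around zero    a = a
around (suc m) a = next6 (around m a)

-- The hexagon minus its edge {i, i+1} is the path i+1, i+2, …, i+6 = i.
cut-path : Fin 6 → Fin 6 → Fin 6
cut-path i t = around (toℕ t) (next6 i)

cut-path-covers : ∀ i j → Σ (Fin 6) λ t → cut-path i t ≡ j
cut-path-covers = toWitness {a? = all? λ i → all? λ j → any? λ t → cut-path i t ≟ j} tt

cut-path-avoids : ∀ i (t : Fin 5) →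
  let j = cut-path i (inject₁ t) in ¬ SameEdge j (next6 j) i (next6 i)
cut-path-avoids = toWitness {a? = all? λ i → all? λ t →
  let j = cut-path i (inject₁ t) in ¬? (sameEdge? j (next6 j) i (next6 i))} tt

cut-path-step : ∀ i (t : Fin 5) → cut-path i (fs t) ≡ next6 (cut-path i (inject₁ t))
cut-path-step i t = cong (λ m → next6 (around m (next6 i))) (sym (toℕ-inject₁ t))

rim-irrefl : ∀ a → ¬ Rim a a
rim-irrefl = toWitness {a? = all? λ a → ¬? (rim? a a)} tt

-- x₂, x₄, x₆ of the paper: the cycle is numbered from 0.
isEven : Fin 6 → Bool
isEven 1F = true
isEven 3F = true
isEven 5F = true
isEven _  = false

isEven⇒InEvens : ∀ {n} (x : Fin 6 → Fin n) {a} → isEven a ≡ true → InEvens x (x a)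
isEven⇒InEvens x {1F} _ = inj₁ refl
isEven⇒InEvens x {3F} _ = inj₂ (inj₁ refl)
isEven⇒InEvens x {5F} _ = inj₂ (inj₂ refl)
isEven⇒InEvens x {0F} ()
isEven⇒InEvens x {2F} ()
isEven⇒InEvens x {4F} ()

isEven-≢0 : ∀ {a} → isEven a ≡ true → a ≢ 0F
isEven-≢0 even refl = contradiction even λ ()

+-mono-≤₃ : ∀ {p q r p′ q′ r′} → p′ ≤ p → q′ ≤ q → r′ ≤ r → p′ + (q′ + (r′ + 0)) ≤ p + (q + (r + 0))
+-mono-≤₃ p′≤p q′≤q r′≤r = +-mono-≤ p′≤p (+-mono-≤ q′≤q (+-mono-≤ r′≤r z≤n))

at-most-one-below-two : ∀ {p q r} {A B C : Set} → ¬ (A × B) → ¬ (B × C) → ¬ (A × C) →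
  2 ≤ p ⊎ (1 ≤ p × A) → 2 ≤ q ⊎ (1 ≤ q × B) → 2 ≤ r ⊎ (1 ≤ r × C) → 5 ≤ p + (q + (r + 0))
at-most-one-below-two _ _ _ (inj₁ 2≤p) (inj₁ 2≤q) (inj₁ 2≤r) = +-mono-≤₃ 2≤p 2≤q (≤-trans (n≤1+n 1) 2≤r)
at-most-one-below-two _ _ _ (inj₁ 2≤p) (inj₁ 2≤q) (inj₂ (1≤r , _)) = +-mono-≤₃ 2≤p 2≤q 1≤r
at-most-one-below-two _ _ _ (inj₁ 2≤p) (inj₂ (1≤q , _)) (inj₁ 2≤r) = +-mono-≤₃ 2≤p 1≤q 2≤r
at-most-one-below-two _ _ _ (inj₂ (1≤p , _)) (inj₁ 2≤q) (inj₁ 2≤r) = +-mono-≤₃ 1≤p 2≤q 2≤r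
at-most-one-below-two _ ¬BC _ (inj₁ _) (inj₂ (_ , b)) (inj₂ (_ , c)) = contradiction (b , c) ¬BC
at-most-one-below-two _ _ ¬AC (inj₂ (_ , a)) _ (inj₂ (_ , c)) = contradiction (a , c) ¬AC
at-most-one-below-two ¬AB _ _ (inj₂ (_ , a)) (inj₂ (_ , b)) (inj₁ _) = contradiction (a , b) ¬AB

module Hexagon {n} (G : Graph n) (x : Fin 6 → Fin n) (cycle : IsCycle6 G x) where

  x-inj : Injective _≡_ _≡_ x
  x-inj = proj₁ cycle _ _

  rim-adj : ∀ {a b} → Rim a b → adj G (x a) (x b) ≡ true
  rim-adj (inj₁ refl) = proj₂ cycle _
  rim-adj (inj₂ refl) = adj-sym G _ _ (proj₂ cycle _)

  VC : VSet n
  VC = Image x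

  RimEdge : Fin n → Fin n → Set
  RimEdge u v = ∃₂ λ a b → Rim a b × x a ≡ u × x b ≡ v

  rimEdge? : ∀ u v → Dec (RimEdge u v)
  rimEdge? u v = any? λ a → any? λ b → rim? a b ×-dec x a ≟ u ×-dec x b ≟ v

  EC : ESet n
  EC u v = does (rimEdge? u v)

  EC-intro : ∀ {a b} → Rim a b → EC (x a) (x b) ≡ true
  EC-intro r = dec-true (rimEdge? _ _) (_ , _ , r , refl , refl)

  EC-sym : ∀ u v → EC u v ≡ true → EC v u ≡ true
  EC-sym u v e with witness (rimEdge? u v) e
  ... | a , b , r , refl , refl = EC-intro (swap r)

  EC-on-image : ∀ a b → EC (x a) (x b) ≡ does (rim? a b)
  EC-on-image a b = does-⇔ (mk⇔ to (λ r → _ , _ , r , refl , refl)) (rimEdge? _ _) (rim? a b)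
    where
    to : RimEdge (x a) (x b) → Rim a b
    to (a′ , b′ , r , xa′≡xa , xb′≡xb) rewrite x-inj xa′≡xa | x-inj xb′≡xb = r

  EC⊆G : ∀ u v → EC u v ≡ true → adj G u v ≡ true
  EC⊆G u v e with witness (rimEdge? u v) e
  ... | _ , _ , r , refl , refl = rim-adj r

  EC-ends : ∀ u v → EC u v ≡ true → VC u ≡ true × VC v ≡ true
  EC-ends u v e with witness (rimEdge? u v) e
  ... | a , b , _ , refl , refl = dec-true (image? x _) (a , refl) , dec-true (image? x _) (b , refl)

  hexagon : Subgraph G
  hexagon = record { V = VC ; E = EC ; E⊆G = EC⊆G ; Esym = EC-sym ; Eends = EC-ends }

  hexagon-minus-rim : ∀ i → Connected VC (delE EC (x i) (x (next6 i)))
  hexagon-minus-rim i =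
    connected-along (delE-sym EC _ _ EC-sym) (x ∘ cut-path i) (λ t → dec-true (image? x _) (_ , refl))
      path-edge covers
    where
    path-edge : ∀ (t : Fin 5) →
      delE EC (x i) (x (next6 i)) (x (cut-path i (inject₁ t))) (x (cut-path i (fs t))) ≡ true
    path-edge t rewrite cut-path-step i t =
      delE-intro EC _ _ _ _ (EC-intro (inj₁ refl)) (cut-path-avoids i t ∘ SameEdge-inj x-inj)
    covers : ∀ u → VC u ≡ true → Σ (Fin 6) λ t → x (cut-path i t) ≡ u
    covers u Vu with witness (image? x u) Vu
    ... | j , refl = let t , p = cut-path-covers i j in t , cong x p

  hexagon-minus-edge : ∀ u v → EC u v ≡ true → Connected VC (delE EC u v)
  hexagon-minus-edge u v e with witness (rimEdge? u v) e
  ... | a , _ , inj₁ refl , refl , refl = hexagon-minus-rim a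
  ... | _ , b , inj₂ refl , refl , refl = Connected-mono (delE-comm EC _ _) (hexagon-minus-rim b)

  hexagon-twoEC : TwoEC VC EC
  hexagon-twoEC = Connected-mono (delE-⊆ EC _ _) (hexagon-minus-rim 0F) , hexagon-minus-edge

  countV-hexagon : countV VC ≡ 6
  countV-hexagon = countV-image x-inj

  countE-hexagon : countE VC EC ≡ 6
  countE-hexagon = *-cancelˡ-≡ _ 6 2 (begin
    2 * countE VC EC
      ≡⟨ countE-double x-inj EC (λ a b → edge-comm EC-sym (x a) (x b)) EC-irrefl ⟩
    ∑[ a < 6 ] ∑[ b < 6 ] 𝟙 (EC (x a) (x b))
      ≡⟨ sum-cong-≗ {6} (λ a → sum-cong-≗ {6} (λ b → cong 𝟙 (EC-on-image a b))) ⟩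
    ∑[ a < 6 ] ∑[ b < 6 ] 𝟙 (does (rim? a b))
      ≡⟨⟩
    12 ∎)
    where
    open ≡-Reasoning
    EC-irrefl : ∀ a → EC (x a) (x a) ≡ false
    EC-irrefl a = trans (EC-on-image a a) (dec-false (rim? a a) (rim-irrefl a))

  hamPath-via-chord : ∀ {c d} → adj G (x c) (x d) ≡ true → (π : Vec (Fin 6) 6) →
    True (all? λ i → all? λ j → (lookup π i ≟ lookup π j) →-dec (i ≟ j)) →
    True (all? λ (t : Fin 5) → rim? (lookup π (inject₁ t)) (lookup π (fs t)) ⊎-dec
                               sameEdge? (lookup π (inject₁ t)) (lookup π (fs t)) c d) →
    HamPath G x (x (lookup π 0F)) (x (lookup π 5F))
  hamPath-via-chord {c} {d} cd π π-inj π-path =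
    x ∘ lookup π , (λ i j → toWitness π-inj i j ∘ x-inj) , (λ i → lookup π i , refl) ,
    path-edge ∘ toWitness π-path , refl , refl
    where
    path-edge : ∀ {a b} → Rim a b ⊎ SameEdge a b c d → adj G (x a) (x b) ≡ true
    path-edge (inj₁ r)                 = rim-adj r
    path-edge (inj₂ (inj₁ (refl , refl))) = cd
    path-edge (inj₂ (inj₂ (refl , refl))) = adj-sym G _ _ cd

  EvensIndependent : Set
  EvensIndependent = ∀ a b → isEven a ≡ true → isEven b ≡ true → adj G (x a) (x b) ≡ false

  chord-absent : ∀ {c d} {A : Set} → ¬ A → (adj G (x c) (x d) ≡ true → A) → adj G (x c) (x d) ≡ false
  chord-absent ¬A chord⇒A = ¬-not (¬A ∘ chord⇒A)

  evens-independent :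
    ¬ (HamEnds G x (x 0F) (x 2F) × HamEnds G x (x 2F) (x 4F)) →
    ¬ (HamEnds G x (x 0F) (x 2F) × HamEnds G x (x 0F) (x 4F)) →
    ¬ (HamEnds G x (x 0F) (x 4F) × HamEnds G x (x 2F) (x 4F)) →
    EvensIndependent
  evens-independent ¬02∧24 ¬02∧04 ¬04∧24 = indep
    where
    no13 : adj G (x 1F) (x 3F) ≡ false
    no13 = chord-absent ¬02∧24 λ c →
      inj₁ (hamPath-via-chord c (0F ∷ 5F ∷ 4F ∷ 3F ∷ 1F ∷ 2F ∷ []) tt tt) ,
      inj₁ (hamPath-via-chord c (2F ∷ 3F ∷ 1F ∷ 0F ∷ 5F ∷ 4F ∷ []) tt tt)
    no35 : adj G (x 3F) (x 5F) ≡ false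
    no35 = chord-absent ¬04∧24 λ c →
      inj₁ (hamPath-via-chord c (0F ∷ 1F ∷ 2F ∷ 3F ∷ 5F ∷ 4F ∷ []) tt tt) ,
      inj₁ (hamPath-via-chord c (2F ∷ 1F ∷ 0F ∷ 5F ∷ 3F ∷ 4F ∷ []) tt tt)
    no51 : adj G (x 5F) (x 1F) ≡ false
    no51 = chord-absent ¬02∧04 λ c →
      inj₁ (hamPath-via-chord c (0F ∷ 1F ∷ 5F ∷ 4F ∷ 3F ∷ 2F ∷ []) tt tt) ,
      inj₁ (hamPath-via-chord c (0F ∷ 5F ∷ 1F ∷ 2F ∷ 3F ∷ 4F ∷ []) tt tt)
    flip : ∀ {u v} → adj G u v ≡ false → adj G v u ≡ false
    flip {u} {v} uv = trans (edge-comm (adj-sym G) v u) uv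
    indep : EvensIndependent
    indep 1F 1F _ _ = irrefl G _
    indep 1F 3F _ _ = no13
    indep 1F 5F _ _ = flip no51
    indep 3F 1F _ _ = flip no13
    indep 3F 3F _ _ = irrefl G _
    indep 3F 5F _ _ = no35
    indep 5F 1F _ _ = no51
    indep 5F 3F _ _ = flip no35
    indep 5F 5F _ _ = irrefl G _
    indep 0F _  () _
    indep 2F _  () _
    indep 4F _  () _
    indep _  0F _ ()
    indep _  2F _ ()
    indep _  4F _ ()

  ExitFromEven : Fin 6 → Fin n → Set
  ExitFromEven a y = isEven a ≡ true × adj G (x a) y ≡ true × ¬ InC x y

  exitFromEven? : ∀ a y → Dec (ExitFromEven a y)
  exitFromEven? a y = isEven a ≟ᵇ true ×-dec adj G (x a) y ≟ᵇ true ×-dec ¬? (image? x y)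

  UniqueExit : Fin n → Fin n → Set
  UniqueExit e₀ y₀ = ∀ a y → ExitFromEven a y → x a ≡ e₀ × y ≡ y₀

  TwoExits : Set
  TwoExits = ∃₂ λ a y → ∃₂ λ a′ y′ → ExitFromEven a y × ExitFromEven a′ y′ × ¬ (x a ≡ x a′ × y ≡ y′)

  sameExit? : ∀ a (y : Fin n) a′ (y′ : Fin n) → Dec (x a ≡ x a′ × y ≡ y′)
  sameExit? a y a′ y′ = x a ≟ x a′ ×-dec y ≟ y′

  two-or-unique-exit : TwoExits ⊎ ∃₂ UniqueExit
  two-or-unique-exit with any? (λ a → any? (λ y → exitFromEven? a y))
  ... | no no-exit = inj₂ (x 0F , x 0F , λ a y exit → contradiction (a , y , exit) no-exit)
  ... | yes (a , y , exit) with any? (λ a′ → any? (λ y′ → exitFromEven? a′ y′ ×-dec ¬? (sameExit? a y a′ y′)))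
  ...   | yes (a′ , y′ , exit′ , distinct) = inj₁ (a , y , a′ , y′ , exit , exit′ , distinct)
  ...   | no no-other = inj₂ (x a , y , λ a′ y′ exit′ →
    let x≡ , y≡ = decidable-stable (sameExit? a y a′ y′) (λ distinct → no-other (a′ , y′ , exit′ , distinct))
    in sym x≡ , sym y≡)

  module _ (indep : EvensIndependent) {e₀ y₀} (unique : UniqueExit e₀ y₀) where

    module _ (S : SpanningSub G) (S-2EC : TwoEC allV (H S)) where

      M : Fin 6 → Fin 6 → ℕ
      M a b = 𝟙 (H S (x a) (x b))

      degree : Fin 6 → ℕ
      degree a = ∑[ b < 6 ] M a b

      S-exit : ∀ {a u} → isEven a ≡ true → H S (x a) u ≡ true → ¬ InC x u → x a ≡ e₀ × u ≡ y₀
      S-exit even au u∉C = unique _ _ (even , H⊆G S _ _ au , u∉C)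

      -- The two S-neighbours of an even vertex cannot both leave V(C): they would be the same exit.
      even-degree : ∀ a → isEven a ≡ true → 2 ≤ degree a ⊎ (1 ≤ degree a × x a ≡ e₀)
      even-degree a even with two-neighbours S-2EC (isEven-≢0 even ∘ x-inj)
      ... | u₁ , u₂ , au₁ , au₂ , u₁≢u₂ with image? x u₁ | image? x u₂
      ... | yes (i₁ , refl) | yes (i₂ , refl) =
        inj₁ (subst₂ (λ p q → p + q ≤ degree a) (cong 𝟙 au₁) (cong 𝟙 au₂) (∑-≥-two-terms (M a) (u₁≢u₂ ∘ cong x)))
      ... | yes (i₁ , refl) | no u₂∉C =
        inj₂ (subst (_≤ degree a) (cong 𝟙 au₁) (∑-≥-term (M a) i₁) , proj₁ (S-exit even au₂ u₂∉C))
      ... | no u₁∉C | yes (i₂ , refl) =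
        inj₂ (subst (_≤ degree a) (cong 𝟙 au₂) (∑-≥-term (M a) i₂) , proj₁ (S-exit even au₁ u₁∉C))
      ... | no u₁∉C | no u₂∉C =
        contradiction (trans (proj₂ (S-exit even au₁ u₁∉C)) (sym (proj₂ (S-exit even au₂ u₂∉C)))) u₁≢u₂

      evens-degree : 5 ≤ ∑[ a < 6 ] (if isEven a then degree a else 0)
      evens-degree = at-most-one-below-two
        (λ (e₁ , e₃) → contradiction (x-inj (trans e₁ (sym e₃))) λ ())
        (λ (e₃ , e₅) → contradiction (x-inj (trans e₃ (sym e₅))) λ ())
        (λ (e₁ , e₅) → contradiction (x-inj (trans e₁ (sym e₅))) λ ())
        (even-degree 1F refl) (even-degree 3F refl) (even-degree 5F refl)

      spanning-edges : 5 ≤ countE VC (H S)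
      spanning-edges = *-cancelˡ-≤ 2 (begin
        10                                                 ≤⟨ *-monoʳ-≤ 2 evens-degree ⟩
        2 * ∑[ a < 6 ] (if isEven a then degree a else 0)  ≤⟨ ∑-independent-degrees isEven M M-sym M-indep ⟩
        ∑[ a < 6 ] ∑[ b < 6 ] M a b                        ≡⟨ countE-double x-inj (H S) H-sym H-irrefl ⟨
        2 * countE VC (H S)                                ∎)
        where
        open ≤-Reasoning
        H-sym : ∀ a b → H S (x a) (x b) ≡ H S (x b) (x a)
        H-sym a b = edge-comm (Hsym S) (x a) (x b)
        H-irrefl : ∀ a → H S (x a) (x a) ≡ false
        H-irrefl a = edge-absent (H⊆G S) (irrefl G (x a))
        M-sym : ∀ a b → M a b ≡ M b a
        M-sym a b = cong 𝟙 (H-sym a b)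
        M-indep : ∀ a b → isEven a ≡ true → isEven b ≡ true → M a b ≡ 0
        M-indep a b ea eb = cong 𝟙 (edge-absent (H⊆G S) (indep a b ea eb))

    hexagon-contractible : Contractible 5 4 G hexagon
    hexagon-contractible = subst (2 ≤_) (sym countV-hexagon) (m≤m+n 2 4) , hexagon-twoEC , λ S S-2EC →
      subst (λ m → 4 * m ≤ 5 * countE VC (H S)) (sym countE-hexagon)
        (≤-trans (n≤1+n 24) (*-monoʳ-≤ 5 (spanning-edges S S-2EC)))

  edges-from-exits : TwoExits →
    Σ (Fin n) λ a → Σ (Fin n) λ b → Σ (Fin n) λ c → Σ (Fin n) λ d →
      adj G a b ≡ true × adj G c d ≡ true × ¬ SameEdge a b c d ×
      ¬ (InC x a × InC x b) × ¬ (InC x c × InC x d) ×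
      (InEvens x a ⊎ InEvens x b) × (InEvens x c ⊎ InEvens x d)
  edges-from-exits (a , y , a′ , y′ , (ea , ay , y∉C) , (ea′ , a′y′ , y′∉C) , distinct) =
    x a , y , x a′ , y′ , ay , a′y′ , different , y∉C ∘ proj₂ , y′∉C ∘ proj₂ ,
    inj₁ (isEven⇒InEvens x ea) , inj₁ (isEven⇒InEvens x ea′)
    where
    different : ¬ SameEdge (x a) y (x a′) y′
    different (inj₁ same)          = distinct same
    different (inj₂ (xa≡y′ , _)) = y′∉C (a , xa≡y′)

lemma8 : ∀ {n} (G : Graph n) → Structured 5 4 G →
    (x : Fin 6 → Fin n) → IsCycle6 G x →
    ¬ (HamEnds G x (x f0) (x (fs (fs f0))) × HamEnds G x (x (fs (fs f0))) (x (fs (fs (fs (fs f0)))))) →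
    ¬ (HamEnds G x (x f0) (x (fs (fs f0))) × HamEnds G x (x f0) (x (fs (fs (fs (fs f0)))))) →
    ¬ (HamEnds G x (x f0) (x (fs (fs (fs (fs f0))))) × HamEnds G x (x (fs (fs f0))) (x (fs (fs (fs (fs f0)))))) →
    Σ (Fin n) λ a → Σ (Fin n) λ b → Σ (Fin n) λ c → Σ (Fin n) λ d →
      adj G a b ≡ true × adj G c d ≡ true × ¬ SameEdge a b c d ×
      ¬ (InC x a × InC x b) × ¬ (InC x c × InC x d) ×
      (InEvens x a ⊎ InEvens x b) × (InEvens x c ⊎ InEvens x d)
lemma8 G (_ , _ , _ , no-small-contractible , _) x cycle ¬02∧24 ¬02∧04 ¬04∧24 =
  [ edges-from-exits , ⊥-elim ∘ unique-exit-impossible ]′ two-or-unique-exit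
  where
  open Hexagon G x cycle
  small : (5 ∸ 4) * countV VC ≤ 2 * 4
  small = subst (λ m → 1 * m ≤ 8) (sym countV-hexagon) (m≤m+n 6 2)
  unique-exit-impossible : ∃₂ UniqueExit → ⊥
  unique-exit-impossible (_ , _ , unique) = no-small-contractible hexagon small
    (hexagon-contractible (evens-independent ¬02∧24 ¬02∧04 ¬04∧24) unique)
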